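{- Let $a$ be an integer. The central transform (defined in the context) of the sequence with generating function $\frac{1+ax}{1-x^3}$ has generating function $$\mathbf{C}\!\left(\frac{1+ax}{1-x^3}\right)=\frac{1+xc(x)^3}{1+(a-1)xc(x)},$$ where $c(x)=\frac{1-\sqrt{1-4x}}{2x}$.
   Context: For a power series $g(x)\in\mathbb{Z}[[x]]$ with $g(0)=1$, let $t_{n,k}=[x^n]\,\frac{1}{1-x}\,\frac{1}{g\left(\frac{x}{1-x}\right)}\left(\frac{x}{1-x}\right)^k$ for $n,k\ge0$, where $[x^n]$ extracts the coefficient of $x^n$. The central transform $\mathbf{C}(g(x))$ is the power series $\sum_{n\ge0}b_nx^n$ with $b_n=t_{2n,n}$. -}

module Defs where

open import Data.Nat as ℕ using (ℕ; zero; suc; _∸_)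
open import Data.Integer using (ℤ; +_; -_; _+_; _-_; _*_; 0ℤ; 1ℤ)
open import Data.List using (List; []; _∷_; map; upTo; zipWith; foldr)
open import Relation.Binary.PropositionalEquality using (_≡_)

sum : List ℤ → ℤ
sum = foldr _+_ 0ℤ

-- A formal power series over ℤ, given by its coefficient sequence:
-- (f n) is the coefficient [x^n] f.
Series : Set
Series = ℕ → ℤ

_≈ₛ_ : Series → Series → Set
f ≈ₛ g = ∀ n → f n ≡ g n
infix 4 _≈ₛ_

const : ℤ → Series
const a zero    = a
const a (suc _) = 0ℤ

oneₛ : Series
oneₛ = const 1ℤ

X : Series
X 1 = 1ℤ
X _ = 0ℤ

_+ₛ_ : Series → Series → Series
(f +ₛ g) n = f n + g n

_-ₛ_ : Series → Series → Series
(f -ₛ g) n = f n - g n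

_·ₛ_ : ℤ → Series → Series
(a ·ₛ f) n = a * f n

_*ₛ_ : Series → Series → Series
(f *ₛ g) n = sum (map (λ i → f i * g (n ∸ i)) (upTo (suc n)))

infixl 7 _*ₛ_ _·ₛ_
infixl 6 _+ₛ_ _-ₛ_

powₛ : Series → ℕ → Series
powₛ f zero    = oneₛ
powₛ f (suc k) = f *ₛ powₛ f k

-- Multiplicative inverse of a series with constant term 1:
-- u_0 = 1, u_n = - Σ_{k=1}^{n} f_k u_{n-k}.
-- invUpTo f n = [u_n, u_{n-1}, …, u_0].
invUpTo : Series → ℕ → List ℤ
invUpTo f zero    = 1ℤ ∷ []
invUpTo f (suc n) with invUpTo f n
... | us = (- sum (zipWith (λ k u → f (suc k) * u) (upTo (suc n)) us)) ∷ us

headOr0 : List ℤ → ℤ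
headOr0 []      = 0ℤ
headOr0 (u ∷ _) = u

-- 1/f, meaningful when f(0) = 1.
invₛ : Series → Series
invₛ f n = headOr0 (invUpTo f n)

-- Composition g(h(x)) = Σ_k g_k h^k, meaningful when h(0) = 0:
-- [x^n] g(h) = Σ_{k=0}^{n} g_k [x^n] h^k.
compₛ : Series → Series → Series
compₛ g h n = sum (map (λ k → g k * powₛ h k n) (upTo (suc n)))

y : Series
y = X *ₛ invₛ (oneₛ -ₛ X)

t : Series → ℕ → ℕ → ℤ
t g n k = (invₛ (oneₛ -ₛ X) *ₛ invₛ (compₛ g y) *ₛ powₛ y k) n

centralTransform : Series → Series
centralTransform g n = t g (2 ℕ.* n) n

-- With y = x/(1-x) we have 1/(1-x) = 1 + y, so t_{2n,n} = [x^{2n}] Φ(y) yⁿ where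
-- Φ(x) = (1+x)/g(x) = (1+x)(1-x³)/(1+ax).  The numbers [x^{2n}] y^{n+k} are binomial
-- coefficients, and Pascal's rule makes them satisfy the same recurrence and boundary values
-- as [xⁿ] wᵏ/(1-w), where w = x c² is the solution of w = x(1+w)²; the boundary case k = 0
-- is the symmetry of the binomial coefficients.  Summing against the coefficients of Φ gives
-- C(g) = Φ(w)/(1-w), and since c = 1 + w this rational function of c simplifies to
-- (1 + x c³)/(1 + (a-1) x c).
module Submission where

open import Defs
open import Data.Integer using (ℤ; +_; _-_; 1ℤ)
open import Relation.Binary.PropositionalEquality using (_≡_)

open import Data.Nat as ℕ using (ℕ; zero; suc; _∸_; _≤_; _<_; z≤n; s≤s)
import Data.Nat.Properties as ℕP
open import Data.Nat.Combinatorics using (_C_; nCk≡nC[n∸k]; nCk+nC[k+1]≡[n+1]C[k+1])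
open import Data.Integer as ℤ using (0ℤ; -1ℤ; -_; _+_; _*_)
import Data.Integer.Properties as ℤP
open import Data.List using (List; []; _∷_; map; upTo; applyUpTo; zipWith)
open import Data.List.Properties using (map-upTo)
open import Data.Maybe using (Maybe; just; nothing)
open import Data.Product using (_,_)
open import Level using (0ℓ)
open import Relation.Nullary using (yes; no)
open import Relation.Binary.PropositionalEquality as ≡ using (refl; cong; cong₂)
import Relation.Binary.Reasoning.Setoid as SetoidReasoning
open import Algebra.Bundles using (CommutativeRing)
import Algebra.Construct.Pointwise as Pointwise
import Algebra.Properties.CommutativeSemigroup as CommutativeSemigroupProperties
import Algebra.Solver.Ring.AlmostCommutativeRing as ACR

open CommutativeSemigroupProperties ℤP.+-commutativeSemigroup using (x∙yz≈y∙xz)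

-- Finite sums

Σ : (ℕ → ℤ) → ℕ → ℤ
Σ f zero    = 0ℤ
Σ f (suc n) = f 0 + Σ (λ i → f (suc i)) n

sum-applyUpTo : ∀ (f : ℕ → ℤ) n → sum (applyUpTo f n) ≡ Σ f n
sum-applyUpTo f zero    = refl
sum-applyUpTo f (suc n) = cong (_+_ (f 0)) (sum-applyUpTo (λ i → f (suc i)) n)

sum-map-upTo : ∀ (f : ℕ → ℤ) n → sum (map f (upTo n)) ≡ Σ f n
sum-map-upTo f n = ≡.trans (cong sum (map-upTo f n)) (sum-applyUpTo f n)

Σ-cong : ∀ {f g : ℕ → ℤ} n → (∀ i → i < n → f i ≡ g i) → Σ f n ≡ Σ g n
Σ-cong zero    f≡g = refl
Σ-cong (suc n) f≡g = cong₂ _+_ (f≡g 0 (s≤s z≤n)) (Σ-cong n (λ i i<n → f≡g (suc i) (s≤s i<n)))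

Σ-cong-≗ : ∀ {f g : ℕ → ℤ} n → (∀ i → f i ≡ g i) → Σ f n ≡ Σ g n
Σ-cong-≗ n f≡g = Σ-cong n (λ i _ → f≡g i)

Σ-zero : ∀ {f : ℕ → ℤ} n → (∀ i → i < n → f i ≡ 0ℤ) → Σ f n ≡ 0ℤ
Σ-zero zero    f≡0 = refl
Σ-zero (suc n) f≡0 = cong₂ _+_ (f≡0 0 (s≤s z≤n)) (Σ-zero n (λ i i<n → f≡0 (suc i) (s≤s i<n)))

Σ-distrib-+ : ∀ (f g : ℕ → ℤ) n → Σ (λ i → f i + g i) n ≡ Σ f n + Σ g n
Σ-distrib-+ f g zero    = refl
Σ-distrib-+ f g (suc n) = begin
  f 0 + g 0 + Σ (λ i → f (suc i) + g (suc i)) n    ≡⟨ cong (_+_ (f 0 + g 0)) (Σ-distrib-+ _ _ n) ⟩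
  f 0 + g 0 + (F + G)                              ≡⟨ ℤP.+-assoc (f 0) (g 0) (F + G) ⟩
  f 0 + (g 0 + (F + G))                            ≡⟨ cong (_+_ (f 0)) (x∙yz≈y∙xz (g 0) F G) ⟩
  f 0 + (F + (g 0 + G))                            ≡⟨ ℤP.+-assoc (f 0) F (g 0 + G) ⟨
  f 0 + F + (g 0 + G)                              ∎
  where
  open ≡.≡-Reasoning
  F = Σ (λ i → f (suc i)) n
  G = Σ (λ i → g (suc i)) n

Σ-distribˡ-* : ∀ a (f : ℕ → ℤ) n → Σ (λ i → a * f i) n ≡ a * Σ f n
Σ-distribˡ-* a f zero    = ≡.sym (ℤP.*-zeroʳ a)
Σ-distribˡ-* a f (suc n) = ≡.trans (cong (_+_ (a * f 0)) (Σ-distribˡ-* a (λ i → f (suc i)) n))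
                                   (≡.sym (ℤP.*-distribˡ-+ a (f 0) _))

Σ-distribʳ-* : ∀ a (f : ℕ → ℤ) n → Σ (λ i → f i * a) n ≡ Σ f n * a
Σ-distribʳ-* a f n = ≡.trans (Σ-cong-≗ n (λ i → ℤP.*-comm (f i) a))
                       (≡.trans (Σ-distribˡ-* a f n) (ℤP.*-comm a (Σ f n)))

Σ-last : ∀ (f : ℕ → ℤ) n → Σ f (suc n) ≡ Σ f n + f n
Σ-last f zero    = ≡.trans (ℤP.+-identityʳ (f 0)) (≡.sym (ℤP.+-identityˡ (f 0)))
Σ-last f (suc n) = ≡.trans (cong (_+_ (f 0)) (Σ-last (λ i → f (suc i)) n)) (≡.sym (ℤP.+-assoc (f 0) _ _))

Σ-reverse : ∀ (f : ℕ → ℤ) n → Σ f n ≡ Σ (λ i → f (n ∸ suc i)) n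
Σ-reverse f zero    = refl
Σ-reverse f (suc n) = ≡.trans (Σ-last f n)
                        (≡.trans (cong (_+ f n) (Σ-reverse f n)) (ℤP.+-comm _ (f n)))

Σ-≤ : ∀ (f : ℕ → ℤ) {m n} → m ≤ n → (∀ i → m ≤ i → f i ≡ 0ℤ) → Σ f n ≡ Σ f m
Σ-≤ f {m} {n} m≤n f≡0 = ≡.trans (cong (Σ f) (≡.sym (ℕP.m∸n+n≡m m≤n))) (extend (n ∸ m))
  where
  extend : ∀ k → Σ f (k ℕ.+ m) ≡ Σ f m
  extend zero    = refl
  extend (suc k) = ≡.trans (Σ-last f (k ℕ.+ m))
                     (≡.trans (cong₂ _+_ (extend k) (f≡0 (k ℕ.+ m) (ℕP.m≤n+m m k))) (ℤP.+-identityʳ _))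

Σ-swap : ∀ (f : ℕ → ℕ → ℤ) m n → Σ (λ i → Σ (f i) n) m ≡ Σ (λ j → Σ (λ i → f i j) m) n
Σ-swap f zero    n = ≡.sym (Σ-zero n (λ _ _ → refl))
Σ-swap f (suc m) n = ≡.trans (cong (_+_ (Σ (f 0) n)) (Σ-swap (λ i → f (suc i)) m n))
                             (≡.sym (Σ-distrib-+ (f 0) (λ j → Σ (λ i → f (suc i) j) m) n))

-- The ring of formal power series

tailₛ : Series → Series
tailₛ f n = f (suc n)

*ₛ-coeff : ∀ f g n → (f *ₛ g) n ≡ Σ (λ i → f i * g (n ∸ i)) (suc n)
*ₛ-coeff f g n = sum-map-upTo (λ i → f i * g (n ∸ i)) (suc n)

*ₛ-coeff₀ : ∀ f g → (f *ₛ g) 0 ≡ f 0 * g 0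
*ₛ-coeff₀ f g = ℤP.+-identityʳ (f 0 * g 0)

*ₛ-coeff-suc : ∀ f g n → (f *ₛ g) (suc n) ≡ f 0 * g (suc n) + (tailₛ f *ₛ g) n
*ₛ-coeff-suc f g n = ≡.trans (*ₛ-coeff f g (suc n))
                       (cong (_+_ (f 0 * g (suc n))) (≡.sym (*ₛ-coeff (tailₛ f) g n)))

*ₛ-cong : ∀ {f f′ g g′} → f ≈ₛ f′ → g ≈ₛ g′ → f *ₛ g ≈ₛ f′ *ₛ g′
*ₛ-cong {f} {f′} {g} {g′} f≈f′ g≈g′ n = begin
  (f *ₛ g) n                              ≡⟨ *ₛ-coeff f g n ⟩
  Σ (λ i → f i * g (n ∸ i)) (suc n)       ≡⟨ Σ-cong-≗ (suc n) (λ i → cong₂ _*_ (f≈f′ i) (g≈g′ (n ∸ i))) ⟩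
  Σ (λ i → f′ i * g′ (n ∸ i)) (suc n)     ≡⟨ *ₛ-coeff f′ g′ n ⟨
  (f′ *ₛ g′) n                            ∎
  where open ≡.≡-Reasoning

*ₛ-comm : ∀ f g → f *ₛ g ≈ₛ g *ₛ f
*ₛ-comm f g n = begin
  (f *ₛ g) n                                     ≡⟨ *ₛ-coeff f g n ⟩
  Σ (λ i → f i * g (n ∸ i)) (suc n)              ≡⟨ Σ-reverse (λ i → f i * g (n ∸ i)) (suc n) ⟩
  Σ (λ i → f (n ∸ i) * g (n ∸ (n ∸ i))) (suc n)  ≡⟨ Σ-cong (suc n) reindex ⟩
  Σ (λ i → g i * f (n ∸ i)) (suc n)              ≡⟨ *ₛ-coeff g f n ⟨
  (g *ₛ f) n                                     ∎
  where
  open ≡.≡-Reasoning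
  reindex : ∀ i → i < suc n → f (n ∸ i) * g (n ∸ (n ∸ i)) ≡ g i * f (n ∸ i)
  reindex i (s≤s i≤n) = ≡.trans (cong (λ j → f (n ∸ i) * g j) (ℕP.m∸[m∸n]≡n i≤n))
                                (ℤP.*-comm (f (n ∸ i)) (g i))

*ₛ-distribʳ : ∀ h f g → (f +ₛ g) *ₛ h ≈ₛ f *ₛ h +ₛ g *ₛ h
*ₛ-distribʳ h f g n = begin
  ((f +ₛ g) *ₛ h) n                                           ≡⟨ *ₛ-coeff (f +ₛ g) h n ⟩
  Σ (λ i → (f i + g i) * h (n ∸ i)) (suc n)
    ≡⟨ Σ-cong-≗ (suc n) (λ i → ℤP.*-distribʳ-+ (h (n ∸ i)) (f i) (g i)) ⟩
  Σ (λ i → f i * h (n ∸ i) + g i * h (n ∸ i)) (suc n)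
    ≡⟨ Σ-distrib-+ (λ i → f i * h (n ∸ i)) (λ i → g i * h (n ∸ i)) (suc n) ⟩
  Σ (λ i → f i * h (n ∸ i)) (suc n) + Σ (λ i → g i * h (n ∸ i)) (suc n)
    ≡⟨ cong₂ _+_ (*ₛ-coeff f h n) (*ₛ-coeff g h n) ⟨
  (f *ₛ h +ₛ g *ₛ h) n                                        ∎
  where open ≡.≡-Reasoning

*ₛ-distribˡ : ∀ h f g → h *ₛ (f +ₛ g) ≈ₛ h *ₛ f +ₛ h *ₛ g
*ₛ-distribˡ h f g n = ≡.trans (*ₛ-comm h (f +ₛ g) n)
  (≡.trans (*ₛ-distribʳ h f g n) (cong₂ _+_ (*ₛ-comm f h n) (*ₛ-comm g h n)))

·ₛ-*ₛ : ∀ a f g → (a ·ₛ f) *ₛ g ≈ₛ a ·ₛ (f *ₛ g)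
·ₛ-*ₛ a f g n = begin
  ((a ·ₛ f) *ₛ g) n                      ≡⟨ *ₛ-coeff (a ·ₛ f) g n ⟩
  Σ (λ i → a * f i * g (n ∸ i)) (suc n)  ≡⟨ Σ-cong-≗ (suc n) (λ i → ℤP.*-assoc a (f i) (g (n ∸ i))) ⟩
  Σ (λ i → a * (f i * g (n ∸ i))) (suc n) ≡⟨ Σ-distribˡ-* a (λ i → f i * g (n ∸ i)) (suc n) ⟩
  a * Σ (λ i → f i * g (n ∸ i)) (suc n)  ≡⟨ cong (a *_) (*ₛ-coeff f g n) ⟨
  (a ·ₛ (f *ₛ g)) n                      ∎
  where open ≡.≡-Reasoning

const-*ₛ : ∀ a g → const a *ₛ g ≈ₛ a ·ₛ g
const-*ₛ a g n = ≡.trans (*ₛ-coeff (const a) g n)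
  (≡.trans (cong (_+_ (a * g n)) (Σ-zero n (λ i _ → ℤP.*-zeroˡ (g (n ∸ suc i))))) (ℤP.+-identityʳ (a * g n)))

·ₛ≈const-*ₛ : ∀ a f → a ·ₛ f ≈ₛ const a *ₛ f
·ₛ≈const-*ₛ a f n = ≡.sym (const-*ₛ a f n)

*ₛ-identityˡ : ∀ g → oneₛ *ₛ g ≈ₛ g
*ₛ-identityˡ g n = ≡.trans (const-*ₛ 1ℤ g n) (ℤP.*-identityˡ (g n))

*ₛ-identityʳ : ∀ g → g *ₛ oneₛ ≈ₛ g
*ₛ-identityʳ g n = ≡.trans (*ₛ-comm g oneₛ n) (*ₛ-identityˡ g n)

*ₛ-assoc : ∀ f g h → (f *ₛ g) *ₛ h ≈ₛ f *ₛ (g *ₛ h)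
*ₛ-assoc f g h zero = begin
  ((f *ₛ g) *ₛ h) 0      ≡⟨ ≡.trans (*ₛ-coeff₀ (f *ₛ g) h) (cong (_* h 0) (*ₛ-coeff₀ f g)) ⟩
  f 0 * g 0 * h 0        ≡⟨ ℤP.*-assoc (f 0) (g 0) (h 0) ⟩
  f 0 * (g 0 * h 0)      ≡⟨ ≡.trans (*ₛ-coeff₀ f (g *ₛ h)) (cong (f 0 *_) (*ₛ-coeff₀ g h)) ⟨
  (f *ₛ (g *ₛ h)) 0      ∎
  where open ≡.≡-Reasoning
*ₛ-assoc f g h (suc n) = begin
  ((f *ₛ g) *ₛ h) (suc n)
    ≡⟨ *ₛ-coeff-suc (f *ₛ g) h n ⟩
  (f *ₛ g) 0 * h (suc n) + (tailₛ (f *ₛ g) *ₛ h) n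
    ≡⟨ cong₂ _+_ (cong (_* h (suc n)) (*ₛ-coeff₀ f g))
                 (*ₛ-cong {g = h} {g′ = h} (*ₛ-coeff-suc f g) (λ _ → refl) n) ⟩
  f 0 * g 0 * h (suc n) + ((f 0 ·ₛ tailₛ g +ₛ tailₛ f *ₛ g) *ₛ h) n
    ≡⟨ cong (_+_ (f 0 * g 0 * h (suc n))) (*ₛ-distribʳ h (f 0 ·ₛ tailₛ g) (tailₛ f *ₛ g) n) ⟩
  f 0 * g 0 * h (suc n) + (((f 0 ·ₛ tailₛ g) *ₛ h) n + ((tailₛ f *ₛ g) *ₛ h) n)
    ≡⟨ cong (_+_ (f 0 * g 0 * h (suc n)))
            (cong₂ _+_ (·ₛ-*ₛ (f 0) (tailₛ g) h n) (*ₛ-assoc (tailₛ f) g h n)) ⟩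
  f 0 * g 0 * h (suc n) + (f 0 * (tailₛ g *ₛ h) n + (tailₛ f *ₛ (g *ₛ h)) n)
    ≡⟨ ℤP.+-assoc (f 0 * g 0 * h (suc n)) _ _ ⟨
  f 0 * g 0 * h (suc n) + f 0 * (tailₛ g *ₛ h) n + (tailₛ f *ₛ (g *ₛ h)) n
    ≡⟨ cong (_+ (tailₛ f *ₛ (g *ₛ h)) n)
            (≡.trans (cong (_+ f 0 * (tailₛ g *ₛ h) n) (ℤP.*-assoc (f 0) (g 0) (h (suc n))))
                     (≡.sym (ℤP.*-distribˡ-+ (f 0) _ _))) ⟩
  f 0 * (g 0 * h (suc n) + (tailₛ g *ₛ h) n) + (tailₛ f *ₛ (g *ₛ h)) n
    ≡⟨ cong (λ z → f 0 * z + (tailₛ f *ₛ (g *ₛ h)) n) (*ₛ-coeff-suc g h n) ⟨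
  f 0 * (g *ₛ h) (suc n) + (tailₛ f *ₛ (g *ₛ h)) n
    ≡⟨ *ₛ-coeff-suc f (g *ₛ h) n ⟨
  (f *ₛ (g *ₛ h)) (suc n) ∎
  where open ≡.≡-Reasoning

seriesRing : CommutativeRing 0ℓ 0ℓ
seriesRing = record
  { Carrier = Series ; _≈_ = _≈ₛ_ ; _+_ = _+ₛ_ ; _*_ = _*ₛ_ ; -_ = λ f n → - f n
  ; 0# = λ _ → 0ℤ ; 1# = oneₛ
  ; isCommutativeRing = record
    { isRing = record
      { +-isAbelianGroup = Pointwise.isAbelianGroup ℕ ℤP.+-0-isAbelianGroup
      ; *-cong           = *ₛ-cong
      ; *-assoc          = *ₛ-assoc
      ; *-identity       = *ₛ-identityˡ , *ₛ-identityʳ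
      ; distrib          = *ₛ-distribˡ , *ₛ-distribʳ
      }
    ; *-comm = *ₛ-comm
    }
  }

module R = CommutativeRing seriesRing
module ≈ₛ-Reasoning = SetoidReasoning R.setoid
module *ₛ = CommutativeSemigroupProperties R.*-commutativeSemigroup

const-homomorphism : ACR._-Raw-AlmostCommutative⟶_ ℤ.+-*-rawRing (ACR.fromCommutativeRing seriesRing)
const-homomorphism = record
  { ⟦_⟧    = const
  ; +-homo = λ { a b zero → refl ; a b (suc n) → refl }
  ; *-homo = λ a b → R.sym (R.trans (const-*ₛ a (const b)) (λ { zero → refl ; (suc n) → ℤP.*-zeroʳ a }))
  ; -‿homo = λ { a zero → refl ; a (suc n) → refl }
  ; 0-homo = λ { zero → refl ; (suc n) → refl }
  ; 1-homo = λ { zero → refl ; (suc n) → refl }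
  }

const-≟ : ∀ a b → Maybe (const a ≈ₛ const b)
const-≟ a b with a ℤ.≟ b
... | yes refl = just R.refl
... | no  _    = nothing

open import Algebra.Solver.Ring ℤ.+-*-rawRing (ACR.fromCommutativeRing seriesRing) const-homomorphism const-≟
  using (Polynomial; solve; _:=_; _:+_; _:*_; _:-_; con)

:horner : ∀ {n} → List ℤ → Polynomial n → Polynomial n
:horner []       p = con 0ℤ
:horner (a ∷ as) p = con a :+ p :* :horner as p

X-*ₛ-coeff₀ : ∀ f → (X *ₛ f) 0 ≡ 0ℤ
X-*ₛ-coeff₀ f = ≡.trans (*ₛ-coeff₀ X f) (ℤP.*-zeroˡ (f 0))

X-*ₛ-coeff-suc : ∀ f n → (X *ₛ f) (suc n) ≡ f n
X-*ₛ-coeff-suc f n = begin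
  (X *ₛ f) (suc n)            ≡⟨ *ₛ-coeff-suc X f n ⟩
  0ℤ + (tailₛ X *ₛ f) n       ≡⟨ ℤP.+-identityˡ _ ⟩
  (tailₛ X *ₛ f) n            ≡⟨ *ₛ-cong {g = f} {g′ = f} tailₛX≈oneₛ (λ _ → refl) n ⟩
  (oneₛ *ₛ f) n               ≡⟨ *ₛ-identityˡ f n ⟩
  f n                         ∎
  where
  open ≡.≡-Reasoning
  tailₛX≈oneₛ : tailₛ X ≈ₛ oneₛ
  tailₛX≈oneₛ zero    = refl
  tailₛX≈oneₛ (suc n) = refl

invₛ-coeff-suc : ∀ f n → invₛ f (suc n) ≡ - Σ (λ k → f (suc k) * invₛ f (n ∸ k)) (suc n)
invₛ-coeff-suc f n = begin
  - sum (zipWith (λ k u → f (suc k) * u) (upTo (suc n)) (invUpTo f n))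
    ≡⟨ cong (λ us → - sum (zipWith (λ k u → f (suc k) * u) (upTo (suc n)) us)) (invUpTo≡ n) ⟩
  - sum (zipWith (λ k u → f (suc k) * u) (upTo (suc n)) (applyUpTo (λ i → invₛ f (n ∸ i)) (suc n)))
    ≡⟨ cong (λ us → - sum us)
            (zipWith-applyUpTo (λ k u → f (suc k) * u) (λ i → i) (λ i → invₛ f (n ∸ i)) (suc n)) ⟩
  - sum (applyUpTo (λ k → f (suc k) * invₛ f (n ∸ k)) (suc n))
    ≡⟨ cong -_ (sum-applyUpTo (λ k → f (suc k) * invₛ f (n ∸ k)) (suc n)) ⟩
  - Σ (λ k → f (suc k) * invₛ f (n ∸ k)) (suc n) ∎
  where
  open ≡.≡-Reasoning
  invUpTo≡ : ∀ n → invUpTo f n ≡ applyUpTo (λ i → invₛ f (n ∸ i)) (suc n)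
  invUpTo≡ zero    = refl
  invUpTo≡ (suc n) = cong (invₛ f (suc n) ∷_) (invUpTo≡ n)
  zipWith-applyUpTo : ∀ (h : ℕ → ℤ → ℤ) (p : ℕ → ℕ) (q : ℕ → ℤ) m →
                      zipWith h (applyUpTo p m) (applyUpTo q m) ≡ applyUpTo (λ i → h (p i) (q i)) m
  zipWith-applyUpTo h p q zero    = refl
  zipWith-applyUpTo h p q (suc m) =
    cong (h (p 0) (q 0) ∷_) (zipWith-applyUpTo h (λ i → p (suc i)) (λ i → q (suc i)) m)

*ₛ-inverseʳ : ∀ u → u 0 ≡ 1ℤ → u *ₛ invₛ u ≈ₛ oneₛ
*ₛ-inverseʳ u u₀≡1 zero = ≡.trans (*ₛ-coeff₀ u (invₛ u)) (cong (_* 1ℤ) u₀≡1)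
*ₛ-inverseʳ u u₀≡1 (suc n) = begin
  (u *ₛ invₛ u) (suc n)                    ≡⟨ *ₛ-coeff-suc u (invₛ u) n ⟩
  u 0 * invₛ u (suc n) + (tailₛ u *ₛ invₛ u) n
    ≡⟨ cong₂ _+_ (≡.trans (cong (_* invₛ u (suc n)) u₀≡1) (ℤP.*-identityˡ _))
                 (*ₛ-coeff (tailₛ u) (invₛ u) n) ⟩
  invₛ u (suc n) + S                       ≡⟨ cong (_+ S) (invₛ-coeff-suc u n) ⟩
  - S + S                                  ≡⟨ ℤP.+-inverseˡ S ⟩
  0ℤ                                       ∎
  where
  open ≡.≡-Reasoning
  S = Σ (λ k → u (suc k) * invₛ u (n ∸ k)) (suc n)

x*u*u⁻¹≈x : ∀ u f → u 0 ≡ 1ℤ → f *ₛ u *ₛ invₛ u ≈ₛ f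
x*u*u⁻¹≈x u f u₀≡1 = begin
  f *ₛ u *ₛ invₛ u     ≈⟨ R.*-assoc f u (invₛ u) ⟩
  f *ₛ (u *ₛ invₛ u)   ≈⟨ R.*-congˡ {f} (*ₛ-inverseʳ u u₀≡1) ⟩
  f *ₛ oneₛ            ≈⟨ R.*-identityʳ f ⟩
  f                    ∎
  where open ≈ₛ-Reasoning

*ₛ-cancelʳ : ∀ u {f g} → u 0 ≡ 1ℤ → f *ₛ u ≈ₛ g *ₛ u → f ≈ₛ g
*ₛ-cancelʳ u {f} {g} u₀≡1 fu≈gu = begin
  f                  ≈⟨ x*u*u⁻¹≈x u f u₀≡1 ⟨
  f *ₛ u *ₛ invₛ u   ≈⟨ R.*-congʳ fu≈gu ⟩
  g *ₛ u *ₛ invₛ u   ≈⟨ x*u*u⁻¹≈x u g u₀≡1 ⟩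
  g                  ∎
  where open ≈ₛ-Reasoning

x*u≈y⇒x≈y*u⁻¹ : ∀ u {f g} → u 0 ≡ 1ℤ → f *ₛ u ≈ₛ g → f ≈ₛ g *ₛ invₛ u
x*u≈y⇒x≈y*u⁻¹ u {f} {g} u₀≡1 fu≈g = R.trans (R.sym (x*u*u⁻¹≈x u f u₀≡1)) (R.*-congʳ fu≈g)

-- Composition with a series of order ≥ 1, and polynomials

compₛ-coeff : ∀ g h n → compₛ g h n ≡ Σ (λ k → g k * powₛ h k n) (suc n)
compₛ-coeff g h n = sum-map-upTo (λ k → g k * powₛ h k n) (suc n)

compₛ-coeff₀ : ∀ g h → compₛ g h 0 ≡ g 0
compₛ-coeff₀ g h = ≡.trans (ℤP.+-identityʳ (g 0 * 1ℤ)) (ℤP.*-identityʳ (g 0))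

powₛ-coeff-< : ∀ h → h 0 ≡ 0ℤ → ∀ k i → i < k → powₛ h k i ≡ 0ℤ
powₛ-coeff-< h h₀≡0 (suc k) zero _ =
  ≡.trans (*ₛ-coeff₀ h (powₛ h k)) (≡.trans (cong (_* powₛ h k 0) h₀≡0) (ℤP.*-zeroˡ (powₛ h k 0)))
powₛ-coeff-< h h₀≡0 (suc k) (suc i) (s≤s i<k) = begin
  (h *ₛ powₛ h k) (suc i)                            ≡⟨ *ₛ-coeff-suc h (powₛ h k) i ⟩
  h 0 * powₛ h k (suc i) + (tailₛ h *ₛ powₛ h k) i
    ≡⟨ cong₂ _+_ (≡.trans (cong (_* powₛ h k (suc i)) h₀≡0) (ℤP.*-zeroˡ (powₛ h k (suc i))))
                 (*ₛ-coeff (tailₛ h) (powₛ h k) i) ⟩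
  0ℤ + Σ (λ j → h (suc j) * powₛ h k (i ∸ j)) (suc i) ≡⟨ ℤP.+-identityˡ _ ⟩
  Σ (λ j → h (suc j) * powₛ h k (i ∸ j)) (suc i)
    ≡⟨ Σ-zero (suc i) (λ j _ → ≡.trans (cong (h (suc j) *_) (powₛ-coeff-< h h₀≡0 k (i ∸ j) (i∸j<k j)))
                                       (ℤP.*-zeroʳ (h (suc j)))) ⟩
  0ℤ                                                 ∎
  where
  open ≡.≡-Reasoning
  i∸j<k : ∀ j → i ∸ j < k
  i∸j<k j = ℕP.≤-<-trans (ℕP.m∸n≤m i j) i<k

powₛ-+ : ∀ h k m → powₛ h k *ₛ powₛ h m ≈ₛ powₛ h (k ℕ.+ m)
powₛ-+ h zero    m = R.*-identityˡ (powₛ h m)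
powₛ-+ h (suc k) m = R.trans (R.*-assoc h (powₛ h k) (powₛ h m)) (R.*-congˡ {h} (powₛ-+ h k m))

-- The sum over k stops at m because h^k = O(x^k).
compₛ-*ₛ-coeff : ∀ φ h F → h 0 ≡ 0ℤ → ∀ m →
                 (compₛ φ h *ₛ F) m ≡ Σ (λ k → φ k * (powₛ h k *ₛ F) m) (suc m)
compₛ-*ₛ-coeff φ h F h₀≡0 m = begin
  (compₛ φ h *ₛ F) m
    ≡⟨ *ₛ-coeff (compₛ φ h) F m ⟩
  Σ (λ i → compₛ φ h i * F (m ∸ i)) (suc m)
    ≡⟨ Σ-cong (suc m) (λ i i≤m → cong (_* F (m ∸ i)) (≡.trans (compₛ-coeff φ h i) (≡.sym (widen i i≤m)))) ⟩
  Σ (λ i → Σ (λ k → φ k * powₛ h k i) (suc m) * F (m ∸ i)) (suc m)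
    ≡⟨ Σ-cong-≗ (suc m) (λ i → ≡.sym (Σ-distribʳ-* (F (m ∸ i)) (λ k → φ k * powₛ h k i) (suc m))) ⟩
  Σ (λ i → Σ (λ k → φ k * powₛ h k i * F (m ∸ i)) (suc m)) (suc m)
    ≡⟨ Σ-swap (λ i k → φ k * powₛ h k i * F (m ∸ i)) (suc m) (suc m) ⟩
  Σ (λ k → Σ (λ i → φ k * powₛ h k i * F (m ∸ i)) (suc m)) (suc m)
    ≡⟨ Σ-cong-≗ (suc m) (λ k → ≡.trans (Σ-cong-≗ (suc m) (λ i → ℤP.*-assoc (φ k) (powₛ h k i) (F (m ∸ i))))
                                      (Σ-distribˡ-* (φ k) (λ i → powₛ h k i * F (m ∸ i)) (suc m))) ⟩
  Σ (λ k → φ k * Σ (λ i → powₛ h k i * F (m ∸ i)) (suc m)) (suc m)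
    ≡⟨ Σ-cong-≗ (suc m) (λ k → cong (φ k *_) (*ₛ-coeff (powₛ h k) F m)) ⟨
  Σ (λ k → φ k * (powₛ h k *ₛ F) m) (suc m) ∎
  where
  open ≡.≡-Reasoning
  widen : ∀ i → i < suc m → Σ (λ k → φ k * powₛ h k i) (suc m) ≡ Σ (λ k → φ k * powₛ h k i) (suc i)
  widen i i<1+m = Σ-≤ (λ k → φ k * powₛ h k i) i<1+m
    (λ k i<k → ≡.trans (cong (φ k *_) (powₛ-coeff-< h h₀≡0 k i i<k)) (ℤP.*-zeroʳ (φ k)))

compₛ-cong : ∀ {f g} h → f ≈ₛ g → compₛ f h ≈ₛ compₛ g h
compₛ-cong {f} {g} h f≈g n = begin
  compₛ f h n                            ≡⟨ compₛ-coeff f h n ⟩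
  Σ (λ k → f k * powₛ h k n) (suc n)     ≡⟨ Σ-cong-≗ (suc n) (λ k → cong (_* powₛ h k n) (f≈g k)) ⟩
  Σ (λ k → g k * powₛ h k n) (suc n)     ≡⟨ compₛ-coeff g h n ⟨
  compₛ g h n                            ∎
  where open ≡.≡-Reasoning

compₛ-+ₛ : ∀ f g h → compₛ (f +ₛ g) h ≈ₛ compₛ f h +ₛ compₛ g h
compₛ-+ₛ f g h n = begin
  compₛ (f +ₛ g) h n
    ≡⟨ compₛ-coeff (f +ₛ g) h n ⟩
  Σ (λ k → (f k + g k) * powₛ h k n) (suc n)
    ≡⟨ Σ-cong-≗ (suc n) (λ k → ℤP.*-distribʳ-+ (powₛ h k n) (f k) (g k)) ⟩
  Σ (λ k → f k * powₛ h k n + g k * powₛ h k n) (suc n)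
    ≡⟨ Σ-distrib-+ (λ k → f k * powₛ h k n) (λ k → g k * powₛ h k n) (suc n) ⟩
  Σ (λ k → f k * powₛ h k n) (suc n) + Σ (λ k → g k * powₛ h k n) (suc n)
    ≡⟨ cong₂ _+_ (compₛ-coeff f h n) (compₛ-coeff g h n) ⟨
  compₛ f h n + compₛ g h n ∎
  where open ≡.≡-Reasoning

compₛ-*ₛ-const : ∀ f a h → compₛ (f *ₛ const a) h ≈ₛ compₛ f h *ₛ const a
compₛ-*ₛ-const f a h n = begin
  compₛ (f *ₛ const a) h n                    ≡⟨ compₛ-cong h (R.trans (*ₛ-comm f (const a)) (const-*ₛ a f)) n ⟩
  compₛ (a ·ₛ f) h n                          ≡⟨ compₛ-coeff (a ·ₛ f) h n ⟩
  Σ (λ k → a * f k * powₛ h k n) (suc n)      ≡⟨ Σ-cong-≗ (suc n) (λ k → ℤP.*-assoc a (f k) (powₛ h k n)) ⟩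
  Σ (λ k → a * (f k * powₛ h k n)) (suc n)    ≡⟨ Σ-distribˡ-* a (λ k → f k * powₛ h k n) (suc n) ⟩
  a * Σ (λ k → f k * powₛ h k n) (suc n)      ≡⟨ cong (a *_) (compₛ-coeff f h n) ⟨
  a * compₛ f h n                             ≡⟨ const-*ₛ a (compₛ f h) n ⟨
  (const a *ₛ compₛ f h) n                    ≡⟨ *ₛ-comm (const a) (compₛ f h) n ⟩
  (compₛ f h *ₛ const a) n                    ∎
  where open ≡.≡-Reasoning

compₛ-X-*ₛ : ∀ f h → h 0 ≡ 0ℤ → compₛ (X *ₛ f) h ≈ₛ h *ₛ compₛ f h
compₛ-X-*ₛ f h h₀≡0 n = begin
  compₛ (X *ₛ f) h n
    ≡⟨ compₛ-coeff (X *ₛ f) h n ⟩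
  (X *ₛ f) 0 * powₛ h 0 n + Σ (λ k → (X *ₛ f) (suc k) * powₛ h (suc k) n) n
    ≡⟨ cong₂ _+_ (≡.trans (cong (_* powₛ h 0 n) (X-*ₛ-coeff₀ f)) (ℤP.*-zeroˡ (powₛ h 0 n)))
                 (Σ-cong-≗ n (λ k → cong (_* powₛ h (suc k) n) (X-*ₛ-coeff-suc f k))) ⟩
  0ℤ + Σ (λ k → f k * powₛ h (suc k) n) n
    ≡⟨ ℤP.+-identityˡ _ ⟩
  Σ (λ k → f k * powₛ h (suc k) n) n
    ≡⟨ Σ-≤ (λ k → f k * powₛ h (suc k) n) (ℕP.n≤1+n n)
           (λ k n≤k → ≡.trans (cong (f k *_) (powₛ-coeff-< h h₀≡0 (suc k) n (s≤s n≤k))) (ℤP.*-zeroʳ (f k))) ⟨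
  Σ (λ k → f k * powₛ h (suc k) n) (suc n)
    ≡⟨ Σ-cong-≗ (suc n) (λ k → cong (f k *_) (*ₛ-comm (powₛ h k) h n)) ⟨
  Σ (λ k → f k * (powₛ h k *ₛ h) n) (suc n)
    ≡⟨ compₛ-*ₛ-coeff f h h h₀≡0 n ⟨
  (compₛ f h *ₛ h) n
    ≡⟨ *ₛ-comm (compₛ f h) h n ⟩
  (h *ₛ compₛ f h) n ∎
  where open ≡.≡-Reasoning

compₛ-oneₛ : ∀ h → compₛ oneₛ h ≈ₛ oneₛ
compₛ-oneₛ h n = begin
  compₛ oneₛ h n                                   ≡⟨ compₛ-coeff oneₛ h n ⟩
  1ℤ * oneₛ n + Σ (λ k → 0ℤ * powₛ h (suc k) n) n  ≡⟨ cong₂ _+_ (ℤP.*-identityˡ (oneₛ n))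
                                                                (Σ-zero n (λ k _ → ℤP.*-zeroˡ (powₛ h (suc k) n))) ⟩
  oneₛ n + 0ℤ                                      ≡⟨ ℤP.+-identityʳ (oneₛ n) ⟩
  oneₛ n                                           ∎
  where open ≡.≡-Reasoning

horner : List ℤ → Series → Series
horner []       h = const 0ℤ
horner (a ∷ as) h = const a +ₛ h *ₛ horner as h

horner-coeff₀ : ∀ b as h → h 0 ≡ 0ℤ → horner (b ∷ as) h 0 ≡ b
horner-coeff₀ b as h h₀≡0 = begin
  b + (h *ₛ horner as h) 0     ≡⟨ cong (_+_ b) (*ₛ-coeff₀ h (horner as h)) ⟩
  b + h 0 * horner as h 0      ≡⟨ cong (λ z → b + z * horner as h 0) h₀≡0 ⟩
  b + 0ℤ                       ≡⟨ ℤP.+-identityʳ b ⟩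
  b                            ∎
  where open ≡.≡-Reasoning

compₛ-*ₛ-horner : ∀ φ as h → h 0 ≡ 0ℤ → compₛ (φ *ₛ horner as X) h ≈ₛ compₛ φ h *ₛ horner as h
compₛ-*ₛ-horner φ []       h h₀≡0 = compₛ-*ₛ-const φ 0ℤ h
compₛ-*ₛ-horner φ (a ∷ as) h h₀≡0 = begin
  compₛ (φ *ₛ (const a +ₛ X *ₛ horner as X)) h
    ≈⟨ compₛ-cong h (R.distribˡ φ (const a) (X *ₛ horner as X)) ⟩
  compₛ (φ *ₛ const a +ₛ φ *ₛ (X *ₛ horner as X)) h
    ≈⟨ compₛ-+ₛ (φ *ₛ const a) (φ *ₛ (X *ₛ horner as X)) h ⟩
  compₛ (φ *ₛ const a) h +ₛ compₛ (φ *ₛ (X *ₛ horner as X)) h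
    ≈⟨ R.+-cong (compₛ-*ₛ-const φ a h) (compₛ-cong h (*ₛ.x∙yz≈y∙xz φ X (horner as X))) ⟩
  compₛ φ h *ₛ const a +ₛ compₛ (X *ₛ (φ *ₛ horner as X)) h
    ≈⟨ R.+-congˡ {compₛ φ h *ₛ const a} (R.trans (compₛ-X-*ₛ (φ *ₛ horner as X) h h₀≡0)
                          (R.*-congˡ {h} (compₛ-*ₛ-horner φ as h h₀≡0))) ⟩
  compₛ φ h *ₛ const a +ₛ h *ₛ (compₛ φ h *ₛ horner as h)
    ≈⟨ R.+-congˡ {compₛ φ h *ₛ const a} (*ₛ.x∙yz≈y∙xz h (compₛ φ h) (horner as h)) ⟩
  compₛ φ h *ₛ const a +ₛ compₛ φ h *ₛ (h *ₛ horner as h)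
    ≈⟨ R.distribˡ (compₛ φ h) (const a) (h *ₛ horner as h) ⟨
  compₛ φ h *ₛ (const a +ₛ h *ₛ horner as h) ∎
  where open ≈ₛ-Reasoning

compₛ-horner : ∀ as h → h 0 ≡ 0ℤ → compₛ (horner as X) h ≈ₛ horner as h
compₛ-horner as h h₀≡0 = begin
  compₛ (horner as X) h           ≈⟨ compₛ-cong h (R.*-identityˡ (horner as X)) ⟨
  compₛ (oneₛ *ₛ horner as X) h   ≈⟨ compₛ-*ₛ-horner oneₛ as h h₀≡0 ⟩
  compₛ oneₛ h *ₛ horner as h     ≈⟨ R.*-congʳ {horner as h} (compₛ-oneₛ h) ⟩
  oneₛ *ₛ horner as h             ≈⟨ R.*-identityˡ (horner as h) ⟩
  horner as h                     ∎
  where open ≈ₛ-Reasoning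

-- Central coefficients of the powers of x/(1-x)

y-coeff₀ : y 0 ≡ 0ℤ
y-coeff₀ = X-*ₛ-coeff₀ (invₛ (oneₛ -ₛ X))

invₛ[1-X]≈1+y : invₛ (oneₛ -ₛ X) ≈ₛ oneₛ +ₛ y
invₛ[1-X]≈1+y = begin
  V                              ≈⟨ solve 2 (λ x v → v := (con 1ℤ :- x) :* v :+ x :* v) R.refl X V ⟩
  (oneₛ -ₛ X) *ₛ V +ₛ X *ₛ V     ≈⟨ R.+-congʳ (*ₛ-inverseʳ (oneₛ -ₛ X) refl) ⟩
  oneₛ +ₛ y                      ∎
  where
  open ≈ₛ-Reasoning
  V = invₛ (oneₛ -ₛ X)

powₛ-y-coeff-suc : ∀ k m → powₛ y (suc k) (suc m) ≡ powₛ y k m + powₛ y (suc k) m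
powₛ-y-coeff-suc k m = begin
  (y *ₛ powₛ y k) (suc m)
    ≡⟨ R.*-congʳ {powₛ y k} (R.*-congˡ {X} invₛ[1-X]≈1+y) (suc m) ⟩
  (X *ₛ (oneₛ +ₛ y) *ₛ powₛ y k) (suc m)
    ≡⟨ solve 3 (λ x u p → x :* (con 1ℤ :+ u) :* p := x :* (p :+ u :* p)) R.refl X y (powₛ y k) (suc m) ⟩
  (X *ₛ (powₛ y k +ₛ powₛ y (suc k))) (suc m)
    ≡⟨ X-*ₛ-coeff-suc (powₛ y k +ₛ powₛ y (suc k)) m ⟩
  powₛ y k m + powₛ y (suc k) m ∎
  where open ≡.≡-Reasoning

powₛ-y-coeff : ∀ k m → powₛ y (suc k) (suc m) ≡ + (m C k)
powₛ-y-coeff zero    zero    = powₛ-y-coeff-suc 0 0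
powₛ-y-coeff (suc k) zero    = ≡.trans (powₛ-y-coeff-suc (suc k) 0)
  (cong₂ _+_ (powₛ-coeff-< y y-coeff₀ (suc k) 0 (s≤s z≤n)) (powₛ-coeff-< y y-coeff₀ (suc (suc k)) 0 (s≤s z≤n)))
powₛ-y-coeff zero    (suc m) = ≡.trans (powₛ-y-coeff-suc 0 (suc m)) (cong (_+_ 0ℤ) (powₛ-y-coeff 0 m))
powₛ-y-coeff (suc k) (suc m) = ≡.trans (powₛ-y-coeff-suc (suc k) (suc m))
  (≡.trans (cong₂ _+_ (powₛ-y-coeff k m) (powₛ-y-coeff (suc k) m)) (cong +_ (nCk+nC[k+1]≡[n+1]C[k+1] m k)))

central : ℕ → ℕ → ℤ
central k n = powₛ y (n ℕ.+ k) (2 ℕ.* n)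

central-vanish : ∀ k n → n < k → central k n ≡ 0ℤ
central-vanish k n n<k = powₛ-coeff-< y y-coeff₀ (n ℕ.+ k) (2 ℕ.* n)
  (≡.subst (_< n ℕ.+ k) (cong (n ℕ.+_) (≡.sym (ℕP.+-identityʳ n))) (ℕP.+-monoʳ-< n n<k))

2[1+n]≡2+2n : ∀ n → 2 ℕ.* suc n ≡ suc (suc (2 ℕ.* n))
2[1+n]≡2+2n n = cong suc (ℕP.+-suc n (n ℕ.+ 0))

central-zero : ∀ n → central 0 n ≡ central 1 n + oneₛ n
central-zero zero    = refl
central-zero (suc n) = begin
  powₛ y (suc n ℕ.+ 0) (2 ℕ.* suc n)          ≡⟨ cong₂ (powₛ y) (ℕP.+-identityʳ (suc n)) (2[1+n]≡2+2n n) ⟩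
  powₛ y (suc n) (suc (suc (2 ℕ.* n)))        ≡⟨ powₛ-y-coeff n (suc (2 ℕ.* n)) ⟩
  + (suc (2 ℕ.* n) C n)
    ≡⟨ cong +_ (≡.trans (nCk≡nC[n∸k] n≤1+2n) (cong (suc (2 ℕ.* n) C_) 1+2n∸n≡1+n)) ⟩
  + (suc (2 ℕ.* n) C suc n)                   ≡⟨ powₛ-y-coeff (suc n) (suc (2 ℕ.* n)) ⟨
  powₛ y (suc (suc n)) (suc (suc (2 ℕ.* n)))  ≡⟨ cong₂ (powₛ y) (ℕP.+-comm (suc n) 1) (2[1+n]≡2+2n n) ⟨
  powₛ y (suc n ℕ.+ 1) (2 ℕ.* suc n)          ≡⟨ ℤP.+-identityʳ _ ⟨
  powₛ y (suc n ℕ.+ 1) (2 ℕ.* suc n) + 0ℤ     ∎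
  where
  open ≡.≡-Reasoning
  n≤1+2n : n ≤ suc (2 ℕ.* n)
  n≤1+2n = ℕP.≤-trans (ℕP.m≤m+n n (n ℕ.+ 0)) (ℕP.n≤1+n _)
  1+2n∸n≡1+n : suc (2 ℕ.* n) ∸ n ≡ suc n
  1+2n∸n≡1+n = ≡.trans (ℕP.+-∸-assoc 1 (ℕP.m≤m+n n (n ℕ.+ 0)))
                       (cong suc (≡.trans (cong (λ m → n ℕ.+ m ∸ n) (ℕP.+-identityʳ n)) (ℕP.m+n∸m≡n n n)))

central-suc : ∀ k n → central (suc k) (suc n) ≡
              central k n + central (suc k) n + central (suc k) n + central (suc (suc k)) n
central-suc k n = begin
  powₛ y (suc n ℕ.+ suc k) (2 ℕ.* suc n)
    ≡⟨ cong₂ (powₛ y) (cong suc (ℕP.+-suc n k)) (2[1+n]≡2+2n n) ⟩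
  powₛ y (suc (suc j)) (suc (suc m))
    ≡⟨ powₛ-y-coeff-suc (suc j) (suc m) ⟩
  powₛ y (suc j) (suc m) + powₛ y (suc (suc j)) (suc m)
    ≡⟨ cong₂ _+_ (powₛ-y-coeff-suc j m) (powₛ-y-coeff-suc (suc j) m) ⟩
  powₛ y j m + powₛ y (suc j) m + (powₛ y (suc j) m + powₛ y (suc (suc j)) m)
    ≡⟨ ℤP.+-assoc (powₛ y j m + powₛ y (suc j) m) _ _ ⟨
  powₛ y j m + powₛ y (suc j) m + powₛ y (suc j) m + powₛ y (suc (suc j)) m
    ≡⟨ cong₂ (λ u v → powₛ y j m + u + u + v) (cong (λ i → powₛ y i m) (ℕP.+-suc n k))
             (cong (λ i → powₛ y i m) (≡.trans (ℕP.+-suc n (suc k)) (cong suc (ℕP.+-suc n k)))) ⟨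
  central k n + central (suc k) n + central (suc k) n + central (suc (suc k)) n ∎
  where
  open ≡.≡-Reasoning
  m = 2 ℕ.* n
  j = n ℕ.+ k

module _ (w : Series) (w≈X[1+w]² : w ≈ₛ X *ₛ ((oneₛ +ₛ w) *ₛ (oneₛ +ₛ w))) where

  w-coeff₀ : w 0 ≡ 0ℤ
  w-coeff₀ = ≡.trans (w≈X[1+w]² 0) (X-*ₛ-coeff₀ ((oneₛ +ₛ w) *ₛ (oneₛ +ₛ w)))

  column : ℕ → Series
  column k = invₛ (oneₛ -ₛ w) *ₛ powₛ w k

  column-zero : column 0 ≈ₛ column 1 +ₛ oneₛ
  column-zero = begin
    K *ₛ oneₛ
      ≈⟨ solve 2 (λ k v → k :* con 1ℤ := k :* (v :* con 1ℤ) :+ (con 1ℤ :- v) :* k) R.refl K w ⟩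
    K *ₛ (w *ₛ oneₛ) +ₛ (oneₛ -ₛ w) *ₛ K
      ≈⟨ R.+-congˡ {K *ₛ (w *ₛ oneₛ)} (*ₛ-inverseʳ (oneₛ -ₛ w) (cong (_-_ 1ℤ) w-coeff₀)) ⟩
    K *ₛ (w *ₛ oneₛ) +ₛ oneₛ ∎
    where
    open ≈ₛ-Reasoning
    K = invₛ (oneₛ -ₛ w)

  column-suc : ∀ k → column (suc k) ≈ₛ X *ₛ (column k +ₛ column (suc k) +ₛ column (suc k) +ₛ column (suc (suc k)))
  column-suc k = begin
    K *ₛ (w *ₛ W)
      ≈⟨ R.*-congˡ {K} (R.*-congʳ {W} w≈X[1+w]²) ⟩
    K *ₛ (X *ₛ ((oneₛ +ₛ w) *ₛ (oneₛ +ₛ w)) *ₛ W)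
      ≈⟨ solve 4 (λ x k v p → k :* (x :* ((con 1ℤ :+ v) :* (con 1ℤ :+ v)) :* p) :=
                  x :* (k :* p :+ k :* (v :* p) :+ k :* (v :* p) :+ k :* (v :* (v :* p)))) R.refl X K w W ⟩
    X *ₛ (column k +ₛ column (suc k) +ₛ column (suc k) +ₛ column (suc (suc k))) ∎
    where
    open ≈ₛ-Reasoning
    K = invₛ (oneₛ -ₛ w)
    W = powₛ w k

  column-suc-coeff₀ : ∀ k → column (suc k) 0 ≡ 0ℤ
  column-suc-coeff₀ k = ≡.trans (column-suc k 0)
    (X-*ₛ-coeff₀ (column k +ₛ column (suc k) +ₛ column (suc k) +ₛ column (suc (suc k))))

  column-suc-coeff-suc : ∀ k n → column (suc k) (suc n) ≡
                         column k n + column (suc k) n + column (suc k) n + column (suc (suc k)) n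
  column-suc-coeff-suc k n = ≡.trans (column-suc k (suc n))
    (X-*ₛ-coeff-suc (column k +ₛ column (suc k) +ₛ column (suc k) +ₛ column (suc (suc k))) n)

  central≡column-step : ∀ n → (∀ j → central j n ≡ column j n) →
                        ∀ k → central (suc k) (suc n) ≡ column (suc k) (suc n)
  central≡column-step n IH k = begin
    central (suc k) (suc n)
      ≡⟨ central-suc k n ⟩
    central k n + central (suc k) n + central (suc k) n + central (suc (suc k)) n
      ≡⟨ cong₂ _+_ (cong₂ (λ u v → u + v + v) (IH k) (IH (suc k))) (IH (suc (suc k))) ⟩
    column k n + column (suc k) n + column (suc k) n + column (suc (suc k)) n
      ≡⟨ column-suc-coeff-suc k n ⟨
    column (suc k) (suc n) ∎
    where open ≡.≡-Reasoning

  central≡column : ∀ n k → central k n ≡ column k n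
  central≡column zero    zero    = refl
  central≡column zero    (suc k) = ≡.trans (central-vanish (suc k) 0 (s≤s z≤n)) (≡.sym (column-suc-coeff₀ k))
  central≡column (suc n) zero    = begin
    central 0 (suc n)          ≡⟨ central-zero (suc n) ⟩
    central 1 (suc n) + 0ℤ     ≡⟨ cong (_+ 0ℤ) (central≡column-step n (central≡column n) 0) ⟩
    column 1 (suc n) + 0ℤ      ≡⟨ column-zero (suc n) ⟨
    column 0 (suc n)           ∎
    where open ≡.≡-Reasoning
  central≡column (suc n) (suc k) = central≡column-step n (central≡column n) k

  compₛ-y-central : ∀ φ n → (compₛ φ y *ₛ powₛ y n) (2 ℕ.* n) ≡ (invₛ (oneₛ -ₛ w) *ₛ compₛ φ w) n
  compₛ-y-central φ n = begin
    (compₛ φ y *ₛ powₛ y n) (2 ℕ.* n)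
      ≡⟨ compₛ-*ₛ-coeff φ y (powₛ y n) y-coeff₀ (2 ℕ.* n) ⟩
    Σ (λ k → φ k * (powₛ y k *ₛ powₛ y n) (2 ℕ.* n)) (suc (2 ℕ.* n))
      ≡⟨ Σ-cong-≗ (suc (2 ℕ.* n)) (λ k → cong (φ k *_)
           (≡.trans (powₛ-+ y k n (2 ℕ.* n)) (cong (λ j → powₛ y j (2 ℕ.* n)) (ℕP.+-comm k n)))) ⟩
    Σ (λ k → φ k * central k n) (suc (2 ℕ.* n))
      ≡⟨ Σ-≤ (λ k → φ k * central k n) (s≤s (ℕP.m≤m+n n (n ℕ.+ 0)))
             (λ k n<k → ≡.trans (cong (φ k *_) (central-vanish k n n<k)) (ℤP.*-zeroʳ (φ k))) ⟩
    Σ (λ k → φ k * central k n) (suc n)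
      ≡⟨ Σ-cong-≗ (suc n) (λ k → cong (φ k *_)
           (≡.trans (central≡column n k) (*ₛ-comm (invₛ (oneₛ -ₛ w)) (powₛ w k) n))) ⟩
    Σ (λ k → φ k * (powₛ w k *ₛ invₛ (oneₛ -ₛ w)) n) (suc n)
      ≡⟨ compₛ-*ₛ-coeff φ w (invₛ (oneₛ -ₛ w)) w-coeff₀ n ⟨
    (compₛ φ w *ₛ invₛ (oneₛ -ₛ w)) n
      ≡⟨ *ₛ-comm (compₛ φ w) (invₛ (oneₛ -ₛ w)) n ⟩
    (invₛ (oneₛ -ₛ w) *ₛ compₛ φ w) n ∎
    where open ≡.≡-Reasoning

-- The central transform of (1 + ax)/(1 - x³)

-- Squaring 2xc = 1 - s gives 4x(c - 1 - x c²) = 1 - 4x - s² = 0; then cancel 4x.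
catalan : ∀ s c → s *ₛ s ≈ₛ oneₛ -ₛ (+ 4) ·ₛ X → (+ 2) ·ₛ X *ₛ c ≈ₛ oneₛ -ₛ s →
          c ≈ₛ oneₛ +ₛ X *ₛ (c *ₛ c)
catalan s c s²≈1-4X 2Xc≈1-s n = ℤP.i-j≡0⇒i≡j (c n) ((oneₛ +ₛ X *ₛ (c *ₛ c)) n)
  (ℤP.*-cancelˡ-≡ (+ 4) (F n) 0ℤ
    (≡.trans (cong (+ 4 *_) (≡.sym (X-*ₛ-coeff-suc F n)))
      (≡.trans (≡.sym (const-*ₛ (+ 4) (X *ₛ F) (suc n))) (4XF≈0 (suc n)))))
  where
  open ≈ₛ-Reasoning
  F e : Series
  F = c -ₛ (oneₛ +ₛ X *ₛ (c *ₛ c))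
  e = const (+ 2) *ₛ X *ₛ c
  e≈1-s : e ≈ₛ oneₛ -ₛ s
  e≈1-s = R.trans (R.*-congʳ {c} (R.sym (·ₛ≈const-*ₛ (+ 2) X))) 2Xc≈1-s
  s²≈1-4X′ : s *ₛ s ≈ₛ oneₛ -ₛ const (+ 4) *ₛ X
  s²≈1-4X′ m = ≡.trans (s²≈1-4X m) (cong (_-_ (oneₛ m)) (·ₛ≈const-*ₛ (+ 4) X m))
  4XF≈0 : const (+ 4) *ₛ (X *ₛ F) ≈ₛ R.0#
  4XF≈0 = begin
    const (+ 4) *ₛ (X *ₛ F)
      ≈⟨ solve 2 (λ x c → con (+ 4) :* (x :* (c :- (con 1ℤ :+ x :* (c :* c)))) :=
                  con (+ 2) :* (con (+ 2) :* x :* c) :- con (+ 4) :* x :- (con (+ 2) :* x :* c) :* (con (+ 2) :* x :* c))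
               R.refl X c ⟩
    const (+ 2) *ₛ e -ₛ const (+ 4) *ₛ X -ₛ e *ₛ e
      ≈⟨ R.+-cong (R.+-congʳ (R.*-congˡ {const (+ 2)} e≈1-s)) (R.-‿cong (R.*-cong e≈1-s e≈1-s)) ⟩
    const (+ 2) *ₛ (oneₛ -ₛ s) -ₛ const (+ 4) *ₛ X -ₛ (oneₛ -ₛ s) *ₛ (oneₛ -ₛ s)
      ≈⟨ solve 2 (λ x s → con (+ 2) :* (con 1ℤ :- s) :- con (+ 4) :* x :- (con 1ℤ :- s) :* (con 1ℤ :- s) :=
                  con 1ℤ :- con (+ 4) :* x :- s :* s) R.refl X s ⟩
    oneₛ -ₛ const (+ 4) *ₛ X -ₛ s *ₛ s
      ≈⟨ R.+-congˡ {oneₛ -ₛ const (+ 4) *ₛ X} (R.-‿cong s²≈1-4X′) ⟩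
    (oneₛ -ₛ const (+ 4) *ₛ X) -ₛ (oneₛ -ₛ const (+ 4) *ₛ X)
      ≈⟨ R.-‿inverseʳ (oneₛ -ₛ const (+ 4) *ₛ X) ⟩
    R.0# ∎

[1-∙³] : Series → Series
[1-∙³] = horner (1ℤ ∷ 0ℤ ∷ 0ℤ ∷ -1ℤ ∷ [])

[1+∙][1-∙³] : Series → Series
[1+∙][1-∙³] = horner (1ℤ ∷ 1ℤ ∷ 0ℤ ∷ -1ℤ ∷ -1ℤ ∷ [])

module _ (a : ℤ) where

  [1+a∙] : Series → Series
  [1+a∙] = horner (1ℤ ∷ a ∷ [])

  Φ : Series
  Φ = [1+∙][1-∙³] X *ₛ invₛ ([1+a∙] X)

  Φ∘h*ₛ[1+ah]≈[1+h][1-h³] : ∀ h → h 0 ≡ 0ℤ →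
    compₛ Φ h *ₛ [1+a∙] h ≈ₛ [1+∙][1-∙³] h
  Φ∘h*ₛ[1+ah]≈[1+h][1-h³] h h₀≡0 = begin
    compₛ Φ h *ₛ [1+a∙] h  ≈⟨ compₛ-*ₛ-horner Φ (1ℤ ∷ a ∷ []) h h₀≡0 ⟨
    compₛ (Φ *ₛ [1+a∙] X) h
      ≈⟨ compₛ-cong {Φ *ₛ [1+a∙] X} h
           (R.trans (*ₛ.xy∙z≈xz∙y ([1+∙][1-∙³] X) (invₛ ([1+a∙] X)) ([1+a∙] X))
                    (x*u*u⁻¹≈x ([1+a∙] X) ([1+∙][1-∙³] X) refl)) ⟩
    compₛ ([1+∙][1-∙³] X) h
      ≈⟨ compₛ-horner (1ℤ ∷ 1ℤ ∷ 0ℤ ∷ -1ℤ ∷ -1ℤ ∷ []) h h₀≡0 ⟩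
    [1+∙][1-∙³] h ∎
    where open ≈ₛ-Reasoning

  g : Series
  g = (oneₛ +ₛ a ·ₛ X) *ₛ invₛ (oneₛ -ₛ powₛ X 3)

  g*ₛ[1-X³]≈[1+aX] : g *ₛ [1-∙³] X ≈ₛ [1+a∙] X
  g*ₛ[1-X³]≈[1+aX] = begin
    A *ₛ I *ₛ [1-∙³] X
      ≈⟨ solve 3 (λ x A I → A :* I :* :horner (1ℤ ∷ 0ℤ ∷ 0ℤ ∷ -1ℤ ∷ []) x :=
                  A :* ((con 1ℤ :- x :* (x :* (x :* con 1ℤ))) :* I)) R.refl X A I ⟩
    A *ₛ ((oneₛ -ₛ powₛ X 3) *ₛ I)
      ≈⟨ R.*-congˡ {A} (*ₛ-inverseʳ (oneₛ -ₛ powₛ X 3) refl) ⟩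
    A *ₛ oneₛ
      ≈⟨ R.*-identityʳ A ⟩
    oneₛ +ₛ a ·ₛ X
      ≈⟨ R.+-congˡ {oneₛ} (·ₛ≈const-*ₛ a X) ⟩
    oneₛ +ₛ const a *ₛ X
      ≈⟨ solve 2 (λ x A → con 1ℤ :+ A :* x := con 1ℤ :+ x :* (A :+ x :* con 0ℤ)) R.refl X (const a) ⟩
    [1+a∙] X ∎
    where
    open ≈ₛ-Reasoning
    A = oneₛ +ₛ a ·ₛ X
    I = invₛ (oneₛ -ₛ powₛ X 3)

  compₛ-g-coeff₀ : compₛ g y 0 ≡ 1ℤ
  compₛ-g-coeff₀ = ≡.trans (compₛ-coeff₀ g y)
    (≡.trans (*ₛ-coeff₀ (oneₛ +ₛ a ·ₛ X) (invₛ (oneₛ -ₛ powₛ X 3)))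
             (cong (λ z → (1ℤ + z) * 1ℤ) (ℤP.*-zeroʳ a)))

  [1-X]⁻¹*ₛ[g∘y]⁻¹≈Φ∘y : invₛ (oneₛ -ₛ X) *ₛ invₛ (compₛ g y) ≈ₛ compₛ Φ y
  [1-X]⁻¹*ₛ[g∘y]⁻¹≈Φ∘y = *ₛ-cancelʳ ([1+a∙] y) (horner-coeff₀ 1ℤ (a ∷ []) y y-coeff₀) (begin
    V *ₛ invₛ G *ₛ [1+a∙] y
      ≈⟨ R.*-congˡ {V *ₛ invₛ G} g∘y*ₛ[1-y³]≈[1+ay] ⟨
    V *ₛ invₛ G *ₛ (G *ₛ [1-∙³] y)
      ≈⟨ solve 4 (λ v i c t → v :* i :* (c :* t) := v :* t :* (c :* i)) R.refl V (invₛ G) G _ ⟩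
    V *ₛ [1-∙³] y *ₛ (G *ₛ invₛ G)
      ≈⟨ R.*-cong (R.*-congʳ {[1-∙³] y} invₛ[1-X]≈1+y) (*ₛ-inverseʳ G compₛ-g-coeff₀) ⟩
    (oneₛ +ₛ y) *ₛ [1-∙³] y *ₛ oneₛ
      ≈⟨ solve 1 (λ y → (con 1ℤ :+ y) :* :horner (1ℤ ∷ 0ℤ ∷ 0ℤ ∷ -1ℤ ∷ []) y :* con 1ℤ :=
                        :horner (1ℤ ∷ 1ℤ ∷ 0ℤ ∷ -1ℤ ∷ -1ℤ ∷ []) y) R.refl y ⟩
    [1+∙][1-∙³] y
      ≈⟨ Φ∘h*ₛ[1+ah]≈[1+h][1-h³] y y-coeff₀ ⟨
    compₛ Φ y *ₛ [1+a∙] y ∎)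
    where
    open ≈ₛ-Reasoning
    V = invₛ (oneₛ -ₛ X)
    G = compₛ g y
    g∘y*ₛ[1-y³]≈[1+ay] : G *ₛ [1-∙³] y ≈ₛ [1+a∙] y
    g∘y*ₛ[1-y³]≈[1+ay] = R.trans (R.sym (compₛ-*ₛ-horner g (1ℤ ∷ 0ℤ ∷ 0ℤ ∷ -1ℤ ∷ []) y y-coeff₀))
                        (R.trans (compₛ-cong y g*ₛ[1-X³]≈[1+aX]) (compₛ-horner (1ℤ ∷ a ∷ []) y y-coeff₀))

  [1-h]⁻¹*ₛΦ∘h*ₛ[1+ah]≈[1+h][1+h+h²] : ∀ h → h 0 ≡ 0ℤ →
    invₛ (oneₛ -ₛ h) *ₛ compₛ Φ h *ₛ [1+a∙] h ≈ₛ (oneₛ +ₛ h) *ₛ (oneₛ +ₛ h *ₛ (oneₛ +ₛ h))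
  [1-h]⁻¹*ₛΦ∘h*ₛ[1+ah]≈[1+h][1+h+h²] h h₀≡0 = begin
    K *ₛ compₛ Φ h *ₛ [1+a∙] h            ≈⟨ R.*-assoc K (compₛ Φ h) ([1+a∙] h) ⟩
    K *ₛ (compₛ Φ h *ₛ [1+a∙] h)          ≈⟨ R.*-congˡ {K} (Φ∘h*ₛ[1+ah]≈[1+h][1-h³] h h₀≡0) ⟩
    K *ₛ [1+∙][1-∙³] h
      ≈⟨ solve 2 (λ k h → k :* :horner (1ℤ ∷ 1ℤ ∷ 0ℤ ∷ -1ℤ ∷ -1ℤ ∷ []) h :=
                        ((con 1ℤ :- h) :* k) :* ((con 1ℤ :+ h) :* (con 1ℤ :+ h :* (con 1ℤ :+ h))))
               R.refl K h ⟩
    ((oneₛ -ₛ h) *ₛ K) *ₛ P               ≈⟨ R.*-congʳ {P} (*ₛ-inverseʳ (oneₛ -ₛ h) (cong (_-_ 1ℤ) h₀≡0)) ⟩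
    oneₛ *ₛ P                             ≈⟨ R.*-identityˡ P ⟩
    P                                     ∎
    where
    open ≈ₛ-Reasoning
    K = invₛ (oneₛ -ₛ h)
    P = (oneₛ +ₛ h) *ₛ (oneₛ +ₛ h *ₛ (oneₛ +ₛ h))

  [1+[a-1]Xc]*ₛc≈[1+a∙][Xc²] : ∀ c → c ≈ₛ oneₛ +ₛ X *ₛ (c *ₛ c) →
    (oneₛ +ₛ (a - 1ℤ) ·ₛ X *ₛ c) *ₛ c ≈ₛ [1+a∙] (X *ₛ (c *ₛ c))
  [1+[a-1]Xc]*ₛc≈[1+a∙][Xc²] c c≈1+Xc² = begin
    (oneₛ +ₛ (a - 1ℤ) ·ₛ X *ₛ c) *ₛ c
      ≈⟨ R.*-congʳ {c} (R.+-congˡ {oneₛ} (R.*-congʳ {c}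
           (R.trans (·ₛ≈const-*ₛ (a - 1ℤ) X) (R.*-congʳ {X} a-1≈)))) ⟩
    (oneₛ +ₛ (const a -ₛ oneₛ) *ₛ X *ₛ c) *ₛ c
      ≈⟨ solve 3 (λ x c A → (con 1ℤ :+ (A :- con 1ℤ) :* x :* c) :* c := c :+ (A :- con 1ℤ) :* (x :* (c :* c)))
               R.refl X c (const a) ⟩
    c +ₛ (const a -ₛ oneₛ) *ₛ w
      ≈⟨ R.+-congʳ c≈1+Xc² ⟩
    oneₛ +ₛ w +ₛ (const a -ₛ oneₛ) *ₛ w
      ≈⟨ solve 2 (λ w A → con 1ℤ :+ w :+ (A :- con 1ℤ) :* w := con 1ℤ :+ w :* (A :+ w :* con 0ℤ))
               R.refl w (const a) ⟩
    [1+a∙] w ∎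
    where
    open ≈ₛ-Reasoning
    w = X *ₛ (c *ₛ c)
    a-1≈ : const (a - 1ℤ) ≈ₛ const a -ₛ oneₛ
    a-1≈ zero    = refl
    a-1≈ (suc n) = refl

  -- Multiplying by c turns 1 + (a - 1) x c into 1 + a w, and 1 + x c³ into (1 + w)(1 + w + w²).
  [1-w]⁻¹*ₛΦ∘w≈[1+Xc³]*ₛ[1+[a-1]Xc]⁻¹ : ∀ c → c ≈ₛ oneₛ +ₛ X *ₛ (c *ₛ c) →
    invₛ (oneₛ -ₛ X *ₛ (c *ₛ c)) *ₛ compₛ Φ (X *ₛ (c *ₛ c))
      ≈ₛ (oneₛ +ₛ X *ₛ powₛ c 3) *ₛ invₛ (oneₛ +ₛ (a - 1ℤ) ·ₛ X *ₛ c)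
  [1-w]⁻¹*ₛΦ∘w≈[1+Xc³]*ₛ[1+[a-1]Xc]⁻¹ c c≈1+w =
    x*u≈y⇒x≈y*u⁻¹ D {Z} {N} D-coeff₀ (*ₛ-cancelʳ c {Z *ₛ D} {N} c-coeff₀ (begin
      Z *ₛ D *ₛ c                                  ≈⟨ R.*-assoc Z D c ⟩
      Z *ₛ (D *ₛ c)                                ≈⟨ R.*-congˡ {Z} ([1+[a-1]Xc]*ₛc≈[1+a∙][Xc²] c c≈1+w) ⟩
      Z *ₛ [1+a∙] w                                ≈⟨ [1-h]⁻¹*ₛΦ∘h*ₛ[1+ah]≈[1+h][1+h+h²] w Xc²-coeff₀ ⟩
      (oneₛ +ₛ w) *ₛ (oneₛ +ₛ w *ₛ (oneₛ +ₛ w))   ≈⟨ R.*-cong c≈1+w (R.+-congˡ {oneₛ} (R.*-congˡ {w} c≈1+w)) ⟨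
      c *ₛ (oneₛ +ₛ w *ₛ c)
        ≈⟨ solve 2 (λ x c → c :* (con 1ℤ :+ x :* (c :* c) :* c) := (con 1ℤ :+ x :* (c :* (c :* (c :* con 1ℤ)))) :* c)
                 R.refl X c ⟩
      N *ₛ c ∎))
    where
    open ≈ₛ-Reasoning
    w = X *ₛ (c *ₛ c)
    Z = invₛ (oneₛ -ₛ w) *ₛ compₛ Φ w
    D = oneₛ +ₛ (a - 1ℤ) ·ₛ X *ₛ c
    N = oneₛ +ₛ X *ₛ powₛ c 3
    Xc²-coeff₀ : w 0 ≡ 0ℤ
    Xc²-coeff₀ = X-*ₛ-coeff₀ (c *ₛ c)
    c-coeff₀ : c 0 ≡ 1ℤ
    c-coeff₀ = ≡.trans (c≈1+w 0) (cong (_+_ 1ℤ) Xc²-coeff₀)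
    D-coeff₀ : D 0 ≡ 1ℤ
    D-coeff₀ = cong (_+_ 1ℤ) (≡.trans (*ₛ-coeff₀ ((a - 1ℤ) ·ₛ X) c)
                 (≡.trans (cong (_* c 0) (ℤP.*-zeroʳ (a - 1ℤ))) (ℤP.*-zeroˡ (c 0))))

mainTheorem7 : (a : ℤ) (s c : Series) →
    s 0 ≡ 1ℤ → s *ₛ s ≈ₛ oneₛ -ₛ (+ 4) ·ₛ X →
    (+ 2) ·ₛ X *ₛ c ≈ₛ oneₛ -ₛ s →
    centralTransform ((oneₛ +ₛ a ·ₛ X) *ₛ invₛ (oneₛ -ₛ powₛ X 3))
      ≈ₛ (oneₛ +ₛ X *ₛ powₛ c 3) *ₛ invₛ (oneₛ +ₛ (a - 1ℤ) ·ₛ X *ₛ c)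
mainTheorem7 a s c _ s²≈1-4X 2Xc≈1-s n = begin
  (invₛ (oneₛ -ₛ X) *ₛ invₛ (compₛ (g a) y) *ₛ powₛ y n) (2 ℕ.* n)
    ≡⟨ R.*-congʳ {powₛ y n} ([1-X]⁻¹*ₛ[g∘y]⁻¹≈Φ∘y a) (2 ℕ.* n) ⟩
  (compₛ (Φ a) y *ₛ powₛ y n) (2 ℕ.* n)
    ≡⟨ compₛ-y-central w w≈X[1+w]² (Φ a) n ⟩
  (invₛ (oneₛ -ₛ w) *ₛ compₛ (Φ a) w) n
    ≡⟨ [1-w]⁻¹*ₛΦ∘w≈[1+Xc³]*ₛ[1+[a-1]Xc]⁻¹ a c c≈1+w n ⟩
  ((oneₛ +ₛ X *ₛ powₛ c 3) *ₛ invₛ (oneₛ +ₛ (a - 1ℤ) ·ₛ X *ₛ c)) n ∎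
  where
  open ≡.≡-Reasoning
  c≈1+w : c ≈ₛ oneₛ +ₛ X *ₛ (c *ₛ c)
  c≈1+w = catalan s c s²≈1-4X 2Xc≈1-s
  w : Series
  w = X *ₛ (c *ₛ c)
  w≈X[1+w]² : w ≈ₛ X *ₛ ((oneₛ +ₛ w) *ₛ (oneₛ +ₛ w))
  w≈X[1+w]² = R.*-congˡ {X} (R.*-cong c≈1+w c≈1+w)
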